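{- Let $G$ be a finite simple graph and $a$ a vertex of $G$. Then \[ J(G \mid a \in W,\ N_G(a)\cap W=\emptyset)=x\,y^{|N_G(a)|}\,J(G-N_G[a]). \]
   Context: For a finite simple graph $G$ and $W\subseteq V(G)$, $N_G[W]$ is the set of vertices that are in $W$ or adjacent to a vertex of $W$, and $N_G(W):=N_G[W]\setminus W$; for a vertex $a$, $N_G(a)$ is the set of neighbours of $a$ and $N_G[a]=N_G(a)\cup\{a\}$. The bivariate domination polynomial is $J(G;x,y)=J(G):=\sum_{W\subseteq V(G)} x^{|W|}y^{|N_G(W)|}$ (so the graph with no vertices has $J=1$). For a condition $c(W)$ on subsets $W\subseteq V(G)$, the conditional polynomial $J(G\mid c(W))$ is $\sum x^{|W|}y^{|N_G(W)|}$ taken only over those $W\subseteq V(G)$ satisfying $c(W)$. For $X\subseteq V(G)$, $G-X$ denotes the graph obtained by deleting the vertices of $X$. -}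

module Defs where

open import Level using (Level)
open import Data.Bool using (Bool; true; false; _∧_; _∨_)
open import Data.Nat using (ℕ; zero; suc)
open import Data.Fin using (Fin)
open import Data.Vec using (Vec; []; _∷_; lookup; tabulate)
open import Data.List using (List; []; _∷_; _++_; map; filter; foldr; allFin)
open import Data.Bool.ListAction using (any)
open import Data.Fin.Subset using (Subset; _∈_; _⊆_; _─_; _∩_; ⁅_⁆; ∣_∣; Empty; Nonempty)
open import Data.Fin.Subset.Properties using (_⊆?_; _∈?_; nonempty?)
open import Data.Product using (_×_)
open import Data.Unit using (⊤)
open import Relation.Nullary using (¬?)
open import Relation.Nullary.Decidable using (_×-dec_; yes)
open import Relation.Unary using (Pred; Decidable)
open import Relation.Binary.PropositionalEquality using (_≡_)
open import Algebra.Bundles using (CommutativeSemiring)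
import Algebra.Definitions.RawSemiring as RS

-- A finite simple graph whose vertex set is a subset V of Fin n.
-- Only adjacencies between vertices of V matter (neighbourhoods are taken inside V).
record Graph (n : ℕ) : Set where
  field
    V      : Subset n
    adj    : Fin n → Fin n → Bool
    sym    : ∀ u v → adj u v ≡ adj v u
    irrefl : ∀ v → adj v v ≡ false
open Graph public

closedNbhd : ∀ {n} → Graph n → Subset n → Subset n
closedNbhd {n} G W =
  tabulate (λ v → lookup (V G) v ∧ (lookup W v ∨ any (λ u → lookup W u ∧ adj G u v) (allFin n)))

openNbhd : ∀ {n} → Graph n → Subset n → Subset n
openNbhd G W = closedNbhd G W ─ W

N : ∀ {n} → Graph n → Fin n → Subset n
N G a = openNbhd G ⁅ a ⁆

N[_] : ∀ {n} → Graph n → Fin n → Subset n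
N[ G ] a = closedNbhd G ⁅ a ⁆

_-ᵥ_ : ∀ {n} → Graph n → Subset n → Graph n
G -ᵥ X = record G { V = V G ─ X }

subsets : ∀ n → List (Subset n)
subsets zero    = [] ∷ []
subsets (suc n) = map (true ∷_) (subsets n) ++ map (false ∷_) (subsets n)

module _ {c ℓ : Level} (R : CommutativeSemiring c ℓ) where
  open CommutativeSemiring R
  open RS rawSemiring using (_^_)

  -- conditional bivariate domination polynomial, evaluated at x, y in R:
  -- sum over W ⊆ V(G) with P W of x^|W| y^|N_G(W)|
  Jc : ∀ {n} → Graph n → (P : Pred (Subset n) Level.zero) → Decidable P → Carrier → Carrier → Carrier
  Jc {n} G P P? x y =
    foldr _+_ 0#
      (map (λ W → (x ^ ∣ W ∣) * (y ^ ∣ openNbhd G W ∣))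
           (filter (λ W → (W ⊆? V G) ×-dec P? W) (subsets n)))

  J : ∀ {n} → Graph n → Carrier → Carrier → Carrier
  J G = Jc G (λ _ → ⊤) (λ _ → yes Data.Unit.tt)

lemma1Cond : ∀ {n} → Graph n → Fin n → Pred (Subset n) Level.zero
lemma1Cond G a W = (a ∈ W) × Empty (N G a ∩ W)

lemma1Cond? : ∀ {n} (G : Graph n) (a : Fin n) → Decidable (lemma1Cond G a)
lemma1Cond? G a W = (a ∈? W) ×-dec ¬? (nonempty? (N G a ∩ W))

module Submission where

-- Write G' = G − N_G[a] and a ⊕ W = {a} ∪ W.  For a ∈ V(G), adding
-- the vertex a is a bijection W ↦ a ⊕ W from the subsets of V(G') onto the
-- subsets W* ⊆ V(G) with a ∈ W* and N_G(a) ∩ W* = ∅ (its inverse removes a).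
-- Along it |a ⊕ W| = 1 + |W|, and N_G(a ⊕ W) is the disjoint union of N_G(a)
-- and N_{G'}(W); so each term of the conditional sum is x·y^{|N_G(a)|} times
-- the corresponding term of J(G').

open import Defs hiding (sym)
import Level
open import Function using (_∘_; Equivalence)
open import Data.Bool using (true; false; T; _∧_; _∨_; if_then_else_)
open import Data.Bool.Properties using (T-≡; T-∧; T-∨)
open import Data.Bool.ListAction using (any)
open import Data.Nat using (suc) renaming (_+_ to _+ℕ_)
open import Data.Nat.Properties using (+-suc)
open import Data.Fin using (Fin; zero; suc)
open import Data.Fin.Subset using (Subset; _∈_; _∉_; _⊆_; _─_; _∩_; _∪_; ⁅_⁆; ⊥; ∣_∣; Empty)
open import Data.Fin.Subset.Properties
  using (_∈?_; _⊆?_; x∈⁅x⁆; x∈⁅y⁆⇒x≡y; ∣⁅x⁆∣≡1; ⊆-antisym; p─q⊆p; x∈p∧x∉q⇒x∈p─q;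
         x∈p∩q⁺; x∈p∩q⁻; drop-∷-Empty; drop-there; x∈p∪q⁺; x∈p∪q⁻; ∪-identityˡ)
open import Data.Vec using ([]; _∷_; lookup; here; there)
open import Data.Vec.Properties using (lookup∘tabulate; []=⇒lookup; lookup⇒[]=)
open import Data.List using (List; []; _∷_; _++_; map; filter; foldr; allFin)
open import Data.List.Relation.Unary.Any as Any using ()
open import Data.List.Relation.Unary.Any.Properties using (any⁺; any⁻)
open import Data.List.Membership.Propositional.Properties using (∈-allFin)
open import Data.Product using (_×_; _,_; ∃; proj₁; proj₂)
open import Data.Sum using (_⊎_; inj₁; inj₂)
open import Data.Unit using (⊤; tt)
open import Data.Empty using (⊥-elim)
open import Relation.Nullary using (¬_; ¬?; Dec; yes; no; does; contradiction)
open import Relation.Nullary.Decidable using (_×-dec_)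
open import Relation.Unary using (Pred; Decidable)
open import Relation.Binary.PropositionalEquality using (_≡_; _≢_; refl; sym; trans; cong; cong₂; subst)
open import Algebra.Bundles using (CommutativeSemiring)
open import Algebra.Definitions.RawSemiring using (_^_)
import Algebra.Properties.Semiring.Exp as SemiringExp
open import Algebra.Properties.CommutativeSemigroup using (interchange)
import Relation.Binary.Reasoning.Setoid as SetoidReasoning

∈⇒T : ∀ {n} {p : Subset n} {v : Fin n} → v ∈ p → T (lookup p v)
∈⇒T v∈p = Equivalence.from T-≡ ([]=⇒lookup v∈p)

T⇒∈ : ∀ {n} {p : Subset n} {v : Fin n} → T (lookup p v) → v ∈ p
T⇒∈ {p = p} {v} t = lookup⇒[]= v p (Equivalence.to T-≡ t)

x∈p─q⇒x∉q : ∀ {n} {p q : Subset n} {v : Fin n} → v ∈ p ─ q → v ∉ q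
x∈p─q⇒x∉q {p = _ ∷ _} {true ∷ _} () here
x∈p─q⇒x∉q {p = _ ∷ _} {_ ∷ _} (there v∈) (there v∈q) = x∈p─q⇒x∉q v∈ v∈q

∣p∪q∣≡∣p∣+∣q∣ : ∀ {n} (p q : Subset n) → Empty (p ∩ q) → ∣ p ∪ q ∣ ≡ ∣ p ∣ +ℕ ∣ q ∣
∣p∪q∣≡∣p∣+∣q∣ []          []          _     = refl
∣p∪q∣≡∣p∣+∣q∣ (true  ∷ p) (true  ∷ q) p∩q=∅ = ⊥-elim (p∩q=∅ (zero , here))
∣p∪q∣≡∣p∣+∣q∣ (true  ∷ p) (false ∷ q) p∩q=∅ = cong suc (∣p∪q∣≡∣p∣+∣q∣ p q (drop-∷-Empty p∩q=∅))
∣p∪q∣≡∣p∣+∣q∣ (false ∷ p) (true  ∷ q) p∩q=∅ =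
  trans (cong suc (∣p∪q∣≡∣p∣+∣q∣ p q (drop-∷-Empty p∩q=∅))) (sym (+-suc ∣ p ∣ ∣ q ∣))
∣p∪q∣≡∣p∣+∣q∣ (false ∷ p) (false ∷ q) p∩q=∅ = ∣p∪q∣≡∣p∣+∣q∣ p q (drop-∷-Empty p∩q=∅)

HasNeighbourIn : ∀ {n} → Graph n → Subset n → Fin n → Set
HasNeighbourIn G W v = ∃ λ u → u ∈ W × T (adj G u v)

∈closedNbhd⁻ : ∀ {n} (G : Graph n) (W : Subset n) {v : Fin n} → v ∈ closedNbhd G W →
  v ∈ V G × (v ∈ W ⊎ HasNeighbourIn G W v)
∈closedNbhd⁻ {n} G W {v} v∈ with Equivalence.to T-∧ (subst T (lookup∘tabulate _ v) (∈⇒T v∈))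
... | v∈V , v∈W∨nb with Equivalence.to T-∨ v∈W∨nb
...   | inj₁ v∈W = T⇒∈ v∈V , inj₁ (T⇒∈ v∈W)
...   | inj₂ nb  with Any.satisfied (any⁻ _ (allFin n) nb)
...     | u , u∈W∧adj with Equivalence.to T-∧ u∈W∧adj
...       | u∈W , u~v = T⇒∈ v∈V , inj₂ (u , T⇒∈ u∈W , u~v)

∈closedNbhd⁺ : ∀ {n} (G : Graph n) (W : Subset n) {v : Fin n} →
  v ∈ V G → v ∈ W ⊎ HasNeighbourIn G W v → v ∈ closedNbhd G W
∈closedNbhd⁺ {n} G W {v} v∈V v∈W∨nb =
  T⇒∈ (subst T (sym (lookup∘tabulate _ v)) (Equivalence.from T-∧ (∈⇒T v∈V , entry v∈W∨nb)))
  where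
  entry : v ∈ W ⊎ HasNeighbourIn G W v → T (lookup W v ∨ any (λ u → lookup W u ∧ adj G u v) (allFin n))
  entry (inj₁ v∈W)             = Equivalence.from T-∨ (inj₁ (∈⇒T v∈W))
  entry (inj₂ (u , u∈W , u~v)) = Equivalence.from T-∨
    (inj₂ (any⁺ _ (Any.map (λ { refl → Equivalence.from T-∧ (∈⇒T u∈W , u~v) }) (∈-allFin u))))

_⊕_ : ∀ {n} → Fin n → Subset n → Subset n
a ⊕ W = ⁅ a ⁆ ∪ W

a∈a⊕W : ∀ {n} (a : Fin n) {W : Subset n} → a ∈ a ⊕ W
a∈a⊕W a = x∈p∪q⁺ (inj₁ (x∈⁅x⁆ a))

W⊆a⊕W : ∀ {n} (a : Fin n) {W : Subset n} → W ⊆ a ⊕ W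
W⊆a⊕W a v∈W = x∈p∪q⁺ (inj₂ v∈W)

∈a⊕W⁻ : ∀ {n} (a : Fin n) (W : Subset n) {v : Fin n} → v ∈ a ⊕ W → v ≡ a ⊎ v ∈ W
∈a⊕W⁻ a W v∈ with x∈p∪q⁻ ⁅ a ⁆ W v∈
... | inj₁ v∈⁅a⁆ = inj₁ (x∈⁅y⁆⇒x≡y a v∈⁅a⁆)
... | inj₂ v∈W   = inj₂ v∈W

∣a⊕W∣ : ∀ {n} (a : Fin n) (W : Subset n) → a ∉ W → ∣ a ⊕ W ∣ ≡ suc ∣ W ∣
∣a⊕W∣ a W a∉W = trans (∣p∪q∣≡∣p∣+∣q∣ ⁅ a ⁆ W disjoint) (cong (_+ℕ ∣ W ∣) (∣⁅x⁆∣≡1 a))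
  where
  disjoint : Empty (⁅ a ⁆ ∩ W)
  disjoint (v , v∈) with x∈p∩q⁻ ⁅ a ⁆ W v∈
  ... | v∈⁅a⁆ , v∈W = a∉W (subst (_∈ W) (x∈⁅y⁆⇒x≡y a v∈⁅a⁆) v∈W)

module Deletion {n} (G : Graph n) (a : Fin n) where

  G' : Graph n
  G' = G -ᵥ N[ G ] a

  ∈N[a]⁻ : ∀ {v} → v ∈ N[ G ] a → v ∈ V G × (v ≡ a ⊎ T (adj G a v))
  ∈N[a]⁻ v∈ with ∈closedNbhd⁻ G ⁅ a ⁆ v∈
  ... | v∈V , inj₁ v∈⁅a⁆                 = v∈V , inj₁ (x∈⁅y⁆⇒x≡y a v∈⁅a⁆)
  ... | v∈V , inj₂ (u , u∈⁅a⁆ , u~v) rewrite x∈⁅y⁆⇒x≡y a u∈⁅a⁆ = v∈V , inj₂ u~v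

  ∈N[a]⁺ : ∀ {v} → v ∈ V G → v ≡ a ⊎ T (adj G a v) → v ∈ N[ G ] a
  ∈N[a]⁺ v∈V (inj₁ refl) = ∈closedNbhd⁺ G ⁅ a ⁆ v∈V (inj₁ (x∈⁅x⁆ a))
  ∈N[a]⁺ v∈V (inj₂ a~v)  = ∈closedNbhd⁺ G ⁅ a ⁆ v∈V (inj₂ (a , x∈⁅x⁆ a , a~v))

  V'⊆V : V G' ⊆ V G
  V'⊆V = p─q⊆p (V G) (N[ G ] a)

  V'∌N[a] : ∀ {v} → v ∈ V G' → v ∉ N[ G ] a
  V'∌N[a] = x∈p─q⇒x∉q

  N⊆N[a] : N G a ⊆ N[ G ] a
  N⊆N[a] = p─q⊆p (N[ G ] a) ⁅ a ⁆

  N∌a : ∀ {v} → v ∈ N G a → v ≢ a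
  N∌a v∈N refl = x∈p─q⇒x∉q v∈N (x∈⁅x⁆ a)

  a∉V' : a ∉ V G'
  a∉V' a∈V' = V'∌N[a] a∈V' (∈N[a]⁺ (V'⊆V a∈V') (inj₁ refl))

  Admissible : Subset n → Set
  Admissible W = W ⊆ V G × lemma1Cond G a W

  admissible⇒⊆V' : ∀ {W} → a ∉ W → Admissible (a ⊕ W) → W ⊆ V G'
  admissible⇒⊆V' {W} a∉W (a⊕W⊆V , _ , N∩a⊕W=∅) {v} v∈W =
    x∈p∧x∉q⇒x∈p─q (a⊕W⊆V (W⊆a⊕W a v∈W)) v∉N[a]
    where
    v∉⁅a⁆ : v ∉ ⁅ a ⁆
    v∉⁅a⁆ v∈⁅a⁆ = a∉W (subst (_∈ W) (x∈⁅y⁆⇒x≡y a v∈⁅a⁆) v∈W)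
    v∉N[a] : v ∉ N[ G ] a
    v∉N[a] v∈N[a] = N∩a⊕W=∅ (v , x∈p∩q⁺ (x∈p∧x∉q⇒x∈p─q v∈N[a] v∉⁅a⁆ , W⊆a⊕W a v∈W))

  ⊆V'⇒admissible : ∀ {W} → a ∈ V G → W ⊆ V G' → Admissible (a ⊕ W)
  ⊆V'⇒admissible {W} a∈V W⊆V' = a⊕W⊆V , a∈a⊕W a , N∩a⊕W=∅
    where
    a⊕W⊆V : a ⊕ W ⊆ V G
    a⊕W⊆V v∈ with ∈a⊕W⁻ a W v∈
    ... | inj₁ refl = a∈V
    ... | inj₂ v∈W  = V'⊆V (W⊆V' v∈W)
    N∩a⊕W=∅ : Empty (N G a ∩ (a ⊕ W))
    N∩a⊕W=∅ (v , v∈) with x∈p∩q⁻ (N G a) (a ⊕ W) v∈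
    ... | v∈N , v∈a⊕W with ∈a⊕W⁻ a W v∈a⊕W
    ...   | inj₁ v≡a = N∌a v∈N v≡a
    ...   | inj₂ v∈W = V'∌N[a] (W⊆V' v∈W) (N⊆N[a] v∈N)

  ∈W⇒⊈V' : ∀ {W} → a ∈ W → ¬ (W ⊆ V G')
  ∈W⇒⊈V' a∈W W⊆V' = a∉V' (W⊆V' a∈W)

  -- N_G(a ⊕ W) ⊆ N_G(a) ∪ N_{G'}(W): a vertex outside N_G[a] dominated by
  -- a ⊕ W is dominated by W, and it survives in G'.
  openNbhd-a⊕W⊆ : ∀ W → openNbhd G (a ⊕ W) ⊆ N G a ∪ openNbhd G' W
  openNbhd-a⊕W⊆ W {v} v∈ with ∈closedNbhd⁻ G (a ⊕ W) (p─q⊆p _ _ v∈) | x∈p─q⇒x∉q v∈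
  ... | _   , inj₁ v∈a⊕W | v∉a⊕W = contradiction v∈a⊕W v∉a⊕W
  ... | v∈V , inj₂ (u , u∈a⊕W , u~v) | v∉a⊕W with v ∈? N[ G ] a
  ...   | yes v∈N[a] = x∈p∪q⁺ (inj₁ (x∈p∧x∉q⇒x∈p─q v∈N[a] (v∉a⊕W ∘ x∈p∪q⁺ ∘ inj₁)))
  ...   | no  v∉N[a] with ∈a⊕W⁻ a W u∈a⊕W
  ...     | inj₁ refl = contradiction (∈N[a]⁺ v∈V (inj₂ u~v)) v∉N[a]
  ...     | inj₂ u∈W  = x∈p∪q⁺ (inj₂ (x∈p∧x∉q⇒x∈p─q v∈N'[W] (v∉a⊕W ∘ W⊆a⊕W a)))
    where
    v∈N'[W] : v ∈ closedNbhd G' W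
    v∈N'[W] = ∈closedNbhd⁺ G' W (x∈p∧x∉q⇒x∈p─q v∈V v∉N[a]) (inj₂ (u , u∈W , u~v))

  ⊆openNbhd-a⊕W : ∀ W → W ⊆ V G' → N G a ∪ openNbhd G' W ⊆ openNbhd G (a ⊕ W)
  ⊆openNbhd-a⊕W W W⊆V' {v} v∈ with x∈p∪q⁻ (N G a) (openNbhd G' W) v∈
  ... | inj₁ v∈N with ∈N[a]⁻ (N⊆N[a] v∈N)
  ...   | _   , inj₁ v≡a = contradiction v≡a (N∌a v∈N)
  ...   | v∈V , inj₂ a~v =
          x∈p∧x∉q⇒x∈p─q (∈closedNbhd⁺ G (a ⊕ W) v∈V (inj₂ (a , a∈a⊕W a , a~v))) v∉a⊕W
    where
    v∉a⊕W : v ∉ a ⊕ W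
    v∉a⊕W v∈a⊕W with ∈a⊕W⁻ a W v∈a⊕W
    ... | inj₁ v≡a = N∌a v∈N v≡a
    ... | inj₂ v∈W = V'∌N[a] (W⊆V' v∈W) (N⊆N[a] v∈N)
  ⊆openNbhd-a⊕W W W⊆V' {v} v∈ | inj₂ v∈N'W with ∈closedNbhd⁻ G' W (p─q⊆p _ _ v∈N'W) | x∈p─q⇒x∉q v∈N'W
  ... | _    , inj₁ v∈W | v∉W = contradiction v∈W v∉W
  ... | v∈V' , inj₂ (u , u∈W , u~v) | v∉W =
        x∈p∧x∉q⇒x∈p─q (∈closedNbhd⁺ G (a ⊕ W) (V'⊆V v∈V') (inj₂ (u , W⊆a⊕W a u∈W , u~v))) v∉a⊕W
    where
    v∉a⊕W : v ∉ a ⊕ W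
    v∉a⊕W v∈a⊕W with ∈a⊕W⁻ a W v∈a⊕W
    ... | inj₁ refl = a∉V' v∈V'
    ... | inj₂ v∈W = v∉W v∈W

  -- N_G(a) and N_{G'}(W) are disjoint: the first lies in N_G[a], the second in V(G').
  N∩N'=∅ : ∀ W → Empty (N G a ∩ openNbhd G' W)
  N∩N'=∅ W (v , v∈) with x∈p∩q⁻ (N G a) (openNbhd G' W) v∈
  ... | v∈N , v∈N'W = V'∌N[a] (proj₁ (∈closedNbhd⁻ G' W (p─q⊆p _ _ v∈N'W))) (N⊆N[a] v∈N)

  ∣openNbhd-a⊕W∣ : ∀ W → W ⊆ V G' → ∣ openNbhd G (a ⊕ W) ∣ ≡ ∣ N G a ∣ +ℕ ∣ openNbhd G' W ∣
  ∣openNbhd-a⊕W∣ W W⊆V' =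
    trans (cong ∣_∣ (⊆-antisym (openNbhd-a⊕W⊆ W) (⊆openNbhd-a⊕W W W⊆V')))
          (∣p∪q∣≡∣p∣+∣q∣ (N G a) (openNbhd G' W) (N∩N'=∅ W))

module Sums {c ℓ} (R : CommutativeSemiring c ℓ) where
  open CommutativeSemiring R hiding (zero) renaming (refl to ≈-refl; sym to ≈-sym; trans to ≈-trans)
  open SetoidReasoning setoid

  sumOver : ∀ {A : Set} → List A → (A → Carrier) → Carrier
  sumOver L F = foldr _+_ 0# (map F L)

  indicator : ∀ {P : Set} → Dec P → Carrier → Carrier
  indicator d u = if does d then u else 0#

  indicator-⊥ : ∀ {P : Set} (d : Dec P) {u : Carrier} → ¬ P → indicator d u ≈ 0#
  indicator-⊥ (yes p) ¬p = contradiction p ¬p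
  indicator-⊥ (no _)  ¬p = ≈-refl

  indicator-scale : ∀ {P Q : Set} (dP : Dec P) (dQ : Dec Q) {u k w : Carrier} →
    (P → Q) → (Q → P) → (Q → u ≈ k * w) → indicator dP u ≈ k * indicator dQ w
  indicator-scale (yes p) (yes q) P⇒Q Q⇒P u≈kw = u≈kw q
  indicator-scale (yes p) (no ¬q) P⇒Q Q⇒P u≈kw = contradiction (P⇒Q p) ¬q
  indicator-scale (no ¬p) (yes q) P⇒Q Q⇒P u≈kw = contradiction (Q⇒P q) ¬p
  indicator-scale (no ¬p) (no ¬q) {k = k} P⇒Q Q⇒P u≈kw = ≈-sym (zeroʳ k)

  sum-filter : ∀ {A : Set} {P : Pred A Level.zero} (P? : Decidable P) (L : List A) (F : A → Carrier) →
    sumOver (filter P? L) F ≈ sumOver L (λ i → indicator (P? i) (F i))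
  sum-filter P? []      F = ≈-refl
  sum-filter P? (i ∷ L) F with does (P? i)
  ... | true  = +-congˡ (sum-filter P? L F)
  ... | false = ≈-trans (sum-filter P? L F) (≈-sym (+-identityˡ _))

  sum-++ : ∀ {A : Set} (L M : List A) (F : A → Carrier) → sumOver (L ++ M) F ≈ sumOver L F + sumOver M F
  sum-++ []      M F = ≈-sym (+-identityˡ _)
  sum-++ (i ∷ L) M F = ≈-trans (+-congˡ (sum-++ L M F)) (≈-sym (+-assoc _ _ _))

  sum-map : ∀ {A B : Set} (g : A → B) (L : List A) (F : B → Carrier) → sumOver (map g L) F ≡ sumOver L (F ∘ g)
  sum-map g []      F = refl
  sum-map g (i ∷ L) F = cong (F (g i) +_) (sum-map g L F)

  sum-cong : ∀ {A : Set} (L : List A) {F H : A → Carrier} → (∀ i → F i ≈ H i) → sumOver L F ≈ sumOver L H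
  sum-cong []      F≈H = ≈-refl
  sum-cong (i ∷ L) F≈H = +-cong (F≈H i) (sum-cong L F≈H)

  sum-zero : ∀ {A : Set} (L : List A) {F : A → Carrier} → (∀ i → F i ≈ 0#) → sumOver L F ≈ 0#
  sum-zero []      F≈0 = ≈-refl
  sum-zero (i ∷ L) F≈0 = ≈-trans (+-cong (F≈0 i) (sum-zero L F≈0)) (+-identityˡ 0#)

  sum-scale : ∀ {A : Set} (L : List A) (k : Carrier) (F : A → Carrier) → sumOver L (λ i → k * F i) ≈ k * sumOver L F
  sum-scale []      k F = ≈-sym (zeroʳ k)
  sum-scale (i ∷ L) k F = ≈-trans (+-congˡ (sum-scale L k F)) (≈-sym (distribˡ k _ _))

  ΣSub : ∀ n → (Subset n → Carrier) → Carrier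
  ΣSub n = sumOver (subsets n)

  ΣSub-suc : ∀ m (F : Subset (suc m) → Carrier) →
    ΣSub (suc m) F ≈ ΣSub m (F ∘ (true ∷_)) + ΣSub m (F ∘ (false ∷_))
  ΣSub-suc m F = begin
    sumOver (map (true ∷_) (subsets m) ++ map (false ∷_) (subsets m)) F
      ≈⟨ sum-++ (map (true ∷_) (subsets m)) (map (false ∷_) (subsets m)) F ⟩
    sumOver (map (true ∷_) (subsets m)) F + sumOver (map (false ∷_) (subsets m)) F
      ≡⟨ cong₂ _+_ (sum-map (true ∷_) (subsets m) F) (sum-map (false ∷_) (subsets m) F) ⟩
    ΣSub m (F ∘ (true ∷_)) + ΣSub m (F ∘ (false ∷_)) ∎

  ΣSub-reindex : ∀ {n} (a : Fin n) (F : Subset n → Carrier) → (∀ W → a ∉ W → F W ≈ 0#) →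
    ΣSub n F ≈ ΣSub n (λ W → indicator (¬? (a ∈? W)) (F (a ⊕ W)))
  ΣSub-reindex {suc m} zero F F-vanishes = begin
    ΣSub (suc m) F
      ≈⟨ ΣSub-suc m F ⟩
    ΣSub m (F ∘ (true ∷_)) + ΣSub m (F ∘ (false ∷_))
      ≈⟨ +-congˡ (sum-zero (subsets m) (λ W → F-vanishes (false ∷ W) λ ())) ⟩
    ΣSub m (F ∘ (true ∷_)) + 0#
      ≈⟨ +-comm _ 0# ⟩
    0# + ΣSub m (F ∘ (true ∷_))
      ≈⟨ +-cong (≈-sym (sum-zero (subsets m) (λ _ → ≈-refl)))
                (sum-cong (subsets m) (λ W → reflexive (cong (F ∘ (true ∷_)) (sym (∪-identityˡ W))))) ⟩
    ΣSub m (λ _ → 0#) + ΣSub m (λ W → F (true ∷ (⊥ ∪ W)))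
      ≈⟨ ≈-sym (ΣSub-suc m _) ⟩
    ΣSub (suc m) (λ W → indicator (¬? (zero ∈? W)) (F (zero ⊕ W))) ∎
  ΣSub-reindex {suc m} (suc a) F F-vanishes = begin
    ΣSub (suc m) F
      ≈⟨ ΣSub-suc m F ⟩
    ΣSub m (F ∘ (true ∷_)) + ΣSub m (F ∘ (false ∷_))
      ≈⟨ +-cong (ΣSub-reindex a (F ∘ (true ∷_)) (λ W a∉W → F-vanishes (true ∷ W) (a∉W ∘ drop-there)))
                (ΣSub-reindex a (F ∘ (false ∷_)) (λ W a∉W → F-vanishes (false ∷ W) (a∉W ∘ drop-there))) ⟩
    ΣSub m (λ W → indicator (¬? (a ∈? W)) (F (true ∷ (a ⊕ W))))
      + ΣSub m (λ W → indicator (¬? (a ∈? W)) (F (false ∷ (a ⊕ W))))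
      ≈⟨ ≈-sym (ΣSub-suc m _) ⟩
    ΣSub (suc m) (λ W → indicator (¬? (suc a ∈? W)) (F (suc a ⊕ W))) ∎

module Correspondence {c ℓ} (R : CommutativeSemiring c ℓ) {n} (G : Graph n) (a : Fin n)
                      (x y : CommutativeSemiring.Carrier R) where
  open CommutativeSemiring R renaming (sym to ≈-sym; trans to ≈-trans)
  open Algebra.Definitions.RawSemiring rawSemiring using () renaming (_^_ to _↑_)
  open SemiringExp semiring using (^-homo-*)
  open SetoidReasoning setoid
  open Sums R
  open Deletion G a

  weight : Graph n → Subset n → Carrier
  weight H W = (x ↑ ∣ W ∣) * (y ↑ ∣ openNbhd H W ∣)

  k : Carrier
  k = x * (y ↑ ∣ N G a ∣)

  admissible? : Decidable Admissible
  admissible? W = (W ⊆? V G) ×-dec lemma1Cond? G a W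

  inV'? : (W : Subset n) → Dec (W ⊆ V G' × ⊤)
  inV'? W = (W ⊆? V G') ×-dec yes tt

  weight-a⊕W : ∀ W → a ∉ W → W ⊆ V G' → weight G (a ⊕ W) ≈ k * weight G' W
  weight-a⊕W W a∉W W⊆V' = begin
    (x ↑ ∣ a ⊕ W ∣) * (y ↑ ∣ openNbhd G (a ⊕ W) ∣)
      ≡⟨ cong₂ (λ i j → (x ↑ i) * (y ↑ j)) (∣a⊕W∣ a W a∉W) (∣openNbhd-a⊕W∣ W W⊆V') ⟩
    (x * (x ↑ ∣ W ∣)) * (y ↑ (∣ N G a ∣ +ℕ ∣ openNbhd G' W ∣))
      ≈⟨ *-congˡ (^-homo-* y ∣ N G a ∣ ∣ openNbhd G' W ∣) ⟩
    (x * (x ↑ ∣ W ∣)) * ((y ↑ ∣ N G a ∣) * (y ↑ ∣ openNbhd G' W ∣))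
      ≈⟨ interchange *-commutativeSemigroup x (x ↑ ∣ W ∣) (y ↑ ∣ N G a ∣) (y ↑ ∣ openNbhd G' W ∣) ⟩
    k * weight G' W ∎

  -- The reindexed left-hand term at W equals k times the right-hand term at W:
  -- both vanish when a ∈ W, and otherwise the conditions agree and the
  -- weights differ by the factor k.
  term : a ∈ V G → ∀ W →
    indicator (¬? (a ∈? W)) (indicator (admissible? (a ⊕ W)) (weight G (a ⊕ W)))
      ≈ k * indicator (inV'? W) (weight G' W)
  term a∈V W with a ∈? W
  ... | yes a∈W = ≈-sym (≈-trans (*-congˡ (indicator-⊥ (inV'? W) (∈W⇒⊈V' a∈W ∘ proj₁))) (zeroʳ k))
  ... | no  a∉W = indicator-scale (admissible? (a ⊕ W)) (inV'? W)
                    (λ adm → admissible⇒⊆V' a∉W adm , tt)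
                    (λ (W⊆V' , _) → ⊆V'⇒admissible a∈V W⊆V')
                    (λ (W⊆V' , _) → weight-a⊕W W a∉W W⊆V')

lemma1 : ∀ {c ℓ} (R : CommutativeSemiring c ℓ) {n : _} (G : Graph n) (a : Fin n) → a ∈ V G →
    (x y : CommutativeSemiring.Carrier R) →
    CommutativeSemiring._≈_ R
      (Jc R G (lemma1Cond G a) (lemma1Cond? G a) x y)
      (CommutativeSemiring._*_ R
        (CommutativeSemiring._*_ R x (_^_ (CommutativeSemiring.rawSemiring R) y ∣ N G a ∣))
        (J R (G -ᵥ N[ G ] a) x y))
lemma1 R {n} G a a∈V x y = begin
  Jc R G (lemma1Cond G a) (lemma1Cond? G a) x y
    ≈⟨ sum-filter admissible? (subsets n) (weight G) ⟩
  ΣSub n (λ W → indicator (admissible? W) (weight G W))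
    ≈⟨ ΣSub-reindex a _ (λ W a∉W → indicator-⊥ (admissible? W) (a∉W ∘ proj₁ ∘ proj₂)) ⟩
  ΣSub n (λ W → indicator (¬? (a ∈? W)) (indicator (admissible? (a ⊕ W)) (weight G (a ⊕ W))))
    ≈⟨ sum-cong (subsets n) (term a∈V) ⟩
  ΣSub n (λ W → k * indicator (inV'? W) (weight G' W))
    ≈⟨ sum-scale (subsets n) k _ ⟩
  k * ΣSub n (λ W → indicator (inV'? W) (weight G' W))
    ≈⟨ *-congˡ (≈-sym (sum-filter inV'? (subsets n) (weight G'))) ⟩
  k * J R G' x y ∎
  where
  open CommutativeSemiring R using (setoid; _*_; *-congˡ) renaming (sym to ≈-sym)
  open SetoidReasoning setoid
  open Sums R
  open Deletion G a using (G')
  open Correspondence R G a x y
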